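{- Fix positive integers $t, l, s$ with $1\leq t\leq l< s$, and positive integers $b_1<b_2<\dots<b_t\leq l$, and let $A$ be the ordered alphabet $A=\{b_1<\dots<b_t<l+1<l+2<\dots<s\}$. Then for all $s$ sufficiently large, there exists an infinite sequence of words $w_k$ over $A$ with multiplicities $\mu(w_k)\to\infty$ as $k\to\infty$.
   Context: Words are finite sequences $w=w_1\cdots w_n$ of positive integers. The (regular) continuant $K(w)$ is defined recursively by $K(\text{empty word})=1$, $K(w_1)=w_1$, and $K(w_1\cdots w_j)=w_jK(w_1\cdots w_{j-1})+K(w_1\cdots w_{j-2})$ for $j\geq 2$; equivalently, $K(w)$ is the denominator of the finite regular continued fraction $\frac{1}{w_1+}\frac{1}{w_2+}\cdots\frac{1}{w_{n-1}+}\frac{1}{w_n}$. Since $K(w)=K(\bar w)$ for the reversal $\bar w=w_n\cdots w_1$, each word is identified with its reversal. The Abelian class $\mathcal{X}(w)$ is the set of all permutations (rearrangements) of $w$, with each word identified with its reversal. The multiplicity $\mu(w)$ of $w$ is the number of elements $x\in\mathcal{X}(w)$ with $K(x)=K(w)$, i.e. the number of times the value $K(w)$ occurs in the multiset $\{K(x): x\in\mathcal{X}(w)\}$. -}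

module Defs where

open import Data.Nat using (ℕ; zero; suc; _+_; _*_; _≤_; _<_; _≟_)
open import Data.Product using (Σ; _×_; _,_; proj₂)
open import Data.List using (List; []; _∷_; map; concatMap; reverse; filter; deduplicate; length)
open import Data.List.Properties using (≡-dec)
open import Data.Sum using (_⊎_)
open import Data.Fin using (Fin)
open import Relation.Nullary.Decidable using (Dec; _⊎-dec_)
open import Relation.Binary.PropositionalEquality using (_≡_)

Word : Set
Word = List ℕ

-- Regular continuant K, following the recursion
--   K(ε) = 1,  K(w₁) = w₁,  K(w₁⋯wⱼ) = wⱼ K(w₁⋯wⱼ₋₁) + K(w₁⋯wⱼ₋₂).
-- contAux reads the word left to right carrying the pair
-- (K(w₁⋯wⱼ₋₁), K(w₁⋯wⱼ)); the initial pair (0 , 1) makes K(w₁) = w₁·1 + 0.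
contAux : ℕ → ℕ → Word → ℕ × ℕ
contAux p q []       = (p , q)
contAux p q (a ∷ as) = contAux q (a * q + p) as

K : Word → ℕ
K w = proj₂ (contAux 0 1 w)

insertions : ℕ → Word → List Word
insertions a []       = (a ∷ []) ∷ []
insertions a (b ∷ bs) = (a ∷ b ∷ bs) ∷ map (b ∷_) (insertions a bs)

perms : Word → List Word
perms []       = [] ∷ []
perms (a ∷ as) = concatMap (insertions a) (perms as)

_~_ : Word → Word → Set
x ~ y = (x ≡ y) ⊎ (x ≡ reverse y)

_~?_ : (x y : Word) → Dec (x ~ y)
x ~? y = ≡-dec _≟_ x y ⊎-dec ≡-dec _≟_ x (reverse y)

-- The Abelian class 𝒳(w): one representative for each rearrangement of w,
-- up to reversal (deduplicate keeps the first member of each ~-class).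
abelianClass : Word → List Word
abelianClass w = deduplicate _~?_ (perms w)

μ : Word → ℕ
μ w = length (filter (λ x → K x ≟ K w) (abelianClass w))

InAlphabet : (t l s : ℕ) → (Fin t → ℕ) → ℕ → Set
InAlphabet t l s b a = (Σ (Fin t) λ i → b i ≡ a) ⊎ ((suc l ≤ a) × (a ≤ s))

module Submission where

-- Call (a, b) a block if L ≤ a, b and
-- (a + 1)(b + 1) ≤ X = 2³³L²; a dyadic staircase of rectangles under this hyperbola supplies
-- N ≥ 8X distinct blocks. Consider the words L a₁ b₁ ⋯ a_{rN} b_{rN} (L + 1) whose block sequence
-- is a concatenation of r permutations of all N blocks. These (N!)^r words are distinct
-- rearrangements of one another, none is the reversal of another (they start with L and end
-- with L + 1), and since K(w) ≤ ∏ (wᵢ + 1) their continuants are at most (L + 1)(L + 2)X^{rN}.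
-- From n^n ≤ 4^n n! we get N! ≥ 2X^N, so for r = 2(L + 1)(L + 2)k the words outnumber k times
-- the possible continuants: by pigeonhole k + 1 of them share one continuant, and each of them
-- counts separately in μ.

open import Defs

open import Data.Nat
  using ( ℕ; zero; suc; _+_; _*_; _^_; _!; ⌊_/2⌋; ⌈_/2⌉; _≤_; _<_; _≟_; _<?_; z≤n; s≤s; s≤s⁻¹
        ; >-nonZero)
open import Data.Nat.Properties
open import Data.Nat.ListAction using (product)
open import Data.Nat.ListAction.Properties using (product-++)
open import Data.Nat.Tactic.RingSolver using (solve-∀)
open import Data.Fin using (Fin) renaming (_<_ to _<ᶠ_)
import Data.Product as Product
open import Data.Product using (Σ; ∃; ∃₂; _×_; _,_; proj₁; proj₂; uncurry)
open import Data.Sum using (inj₁; inj₂)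
open import Data.Empty using (⊥-elim)
open import Data.List
  using (List; []; _∷_; _++_; map; concatMap; filter; applyUpTo; cartesianProduct; length; reverse)
open import Data.List.Properties
  using ( ∷-injective; ∷-injectiveˡ; ∷-injectiveʳ; ∷ʳ-injectiveˡ; ++-cancelˡ; length-map; length-++
        ; length-++-sucʳ; length-applyUpTo; map-++; concatMap-cong; reverse-++; unfold-reverse
        ; reverse-involutive)
open import Data.List.Membership.Propositional using (_∈_; _∉_; find; lose)
open import Data.List.Membership.Propositional.Properties
  using ( ∈-map⁺; ∈-map⁻; ∈-++⁻; ∈-++⁺ˡ; ∈-++⁺ʳ; ∈-∃++; ∈-concatMap⁺; ∈-concatMap⁻
        ; ∈-filter⁺; ∈-filter⁻; ∈-applyUpTo⁻; ∈-cartesianProduct⁻)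
open import Data.List.Relation.Unary.Any using (here; there)
import Data.List.Relation.Unary.Any as Any
import Data.List.Relation.Unary.Any.Properties as Any
open import Data.List.Relation.Unary.All as All using (All; []; _∷_)
import Data.List.Relation.Unary.All.Properties as All
open import Data.List.Relation.Unary.AllPairs using ([]; _∷_)
open import Data.List.Relation.Unary.Unique.Propositional using (Unique)
import Data.List.Relation.Unary.Unique.Propositional.Properties as Unique
open import Data.List.Relation.Binary.Disjoint.Propositional using (Disjoint)
open import Data.List.Relation.Binary.Sublist.Propositional.Properties
  using (filter-⊆; filter⁺; length-mono-≤)
import Data.List.Relation.Binary.Permutation.Propositional as ↭
open import Data.List.Relation.Binary.Permutation.Propositional
  using (_↭_; ↭-refl; ↭-sym; ↭-trans; ↭-prep; ↭-swap)
open import Data.List.Relation.Binary.Permutation.Propositional.Properties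
  using (All-resp-↭; ∈-resp-↭; ↭-length; ↭-empty-inv; drop-mid; shifts; ++⁺; ++⁺ʳ)
open import Function using (_∘_)
open import Relation.Nullary using (yes; no; ¬?)
open import Relation.Unary using (Decidable)
open import Relation.Binary.PropositionalEquality
  using (_≡_; _≢_; refl; sym; trans; cong; cong₂; subst; module ≡-Reasoning)

-- Continuants

contAux-++ : ∀ p q w v → contAux p q (w ++ v) ≡ uncurry contAux (contAux p q w) v
contAux-++ p q []      v = refl
contAux-++ p q (a ∷ w) v = contAux-++ q (a * q + p) w v

-- The continuant of w with its first letter deleted.
K₀ : Word → ℕ
K₀ w = proj₂ (contAux 1 0 w)

contAux-linear : ∀ p q w → proj₂ (contAux p q w) ≡ p * K₀ w + q * K w
contAux-linear p q []      = sym (cong₂ _+_ (*-zeroʳ p) (*-identityʳ q))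
contAux-linear p q (a ∷ w) = begin
  proj₂ (contAux q (a * q + p) w)  ≡⟨ contAux-linear q (a * q + p) w ⟩
  q * K₀ w + (a * q + p) * K w     ≡⟨ regroup a p q (K₀ w) (K w) ⟩
  p * (0 * K₀ w + (a * 0 + 1) * K w) + q * (1 * K₀ w + (a * 1 + 0) * K w)
    ≡⟨ cong₂ (λ x y → p * x + q * y) (contAux-linear 0 (a * 0 + 1) w) (contAux-linear 1 (a * 1 + 0) w) ⟨
  p * K₀ (a ∷ w) + q * K (a ∷ w)   ∎
  where
  open ≡-Reasoning
  regroup : ∀ a p q x y →
    q * x + (a * q + p) * y ≡ p * (0 * x + (a * 0 + 1) * y) + q * (1 * x + (a * 1 + 0) * y)
  regroup = solve-∀

K₀-cons : ∀ a w → K₀ (a ∷ w) ≡ K w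
K₀-cons a w = trans (contAux-linear 0 (a * 0 + 1) w)
                    (trans (cong (λ n → (n + 1) * K w) (*-zeroʳ a)) (+-identityʳ (K w)))

K-cons : ∀ a w → K (a ∷ w) ≡ a * K w + K₀ w
K-cons a w = trans (contAux-linear 1 (a * 1 + 0) w) (regroup a (K₀ w) (K w))
  where
  regroup : ∀ a x y → 1 * x + (a * 1 + 0) * y ≡ a * y + x
  regroup = solve-∀

K-cons₂ : ∀ a b w → K (a ∷ b ∷ w) ≡ a * K (b ∷ w) + K w
K-cons₂ a b w = trans (K-cons a (b ∷ w)) (cong (a * K (b ∷ w) +_) (K₀-cons b w))

K-snoc₂ : ∀ w b a → K (w ++ b ∷ a ∷ []) ≡ a * K (w ++ b ∷ []) + K w
K-snoc₂ w b a = trans (cong proj₂ (contAux-++ 0 1 w (b ∷ a ∷ [])))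
                      (cong (λ x → a * x + K w) (sym (cong proj₂ (contAux-++ 0 1 w (b ∷ [])))))

K-reverse : ∀ w → K (reverse w) ≡ K w
K-reverse []          = refl
K-reverse (a ∷ [])    = refl
K-reverse (a ∷ b ∷ w) = begin
  K (reverse (a ∷ b ∷ w))                   ≡⟨ cong K (reverse-++ (a ∷ b ∷ []) w) ⟩
  K (reverse w ++ b ∷ a ∷ [])               ≡⟨ K-snoc₂ (reverse w) b a ⟩
  a * K (reverse w ++ b ∷ []) + K (reverse w) ≡⟨ cong (λ x → a * K x + K (reverse w)) (unfold-reverse b w) ⟨
  a * K (reverse (b ∷ w)) + K (reverse w)   ≡⟨ cong₂ (λ x y → a * x + y) (K-reverse (b ∷ w)) (K-reverse w) ⟩
  a * K (b ∷ w) + K w                       ≡⟨ K-cons₂ a b w ⟨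
  K (a ∷ b ∷ w)                             ∎
  where open ≡-Reasoning

sucProduct : Word → ℕ
sucProduct w = product (map suc w)

sucProduct-++ : ∀ v w → sucProduct (v ++ w) ≡ sucProduct v * sucProduct w
sucProduct-++ v w = trans (cong product (map-++ suc v w)) (product-++ (map suc v) (map suc w))

contAux≤sucProduct : ∀ w {p q B} → p ≤ B → q ≤ B →
  proj₁ (contAux p q w) ≤ B * sucProduct w × proj₂ (contAux p q w) ≤ B * sucProduct w
contAux≤sucProduct []      {B = B} p≤B q≤B =
  ≤-trans p≤B (≤-reflexive (sym (*-identityʳ B))) , ≤-trans q≤B (≤-reflexive (sym (*-identityʳ B)))
contAux≤sucProduct (a ∷ w) {p} {q} {B} p≤B q≤B =
  Product.map (λ h → ≤-trans h (≤-reflexive reassoc)) (λ h → ≤-trans h (≤-reflexive reassoc))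
    (contAux≤sucProduct w (≤-trans q≤B (m≤n*m B (suc a))) aq+p≤)
  where
  aq+p≤ : a * q + p ≤ suc a * B
  aq+p≤ = ≤-trans (+-mono-≤ (*-monoʳ-≤ a q≤B) p≤B) (≤-reflexive (+-comm (a * B) B))
  reassoc : suc a * B * sucProduct w ≡ B * (suc a * sucProduct w)
  reassoc = trans (cong (_* sucProduct w) (*-comm (suc a) B)) (*-assoc B (suc a) (sucProduct w))

K≤sucProduct : ∀ w → K w ≤ sucProduct w
K≤sucProduct w =
  ≤-trans (proj₂ (contAux≤sucProduct w {B = 1} z≤n ≤-refl)) (≤-reflexive (*-identityˡ (sucProduct w)))

module _ {A B : Set} where

  length-concatMap-const : ∀ (f : A → List B) n xs → (∀ {x} → x ∈ xs → length (f x) ≡ n) →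
    length (concatMap f xs) ≡ length xs * n
  length-concatMap-const f n []       _   = refl
  length-concatMap-const f n (x ∷ xs) len =
    trans (length-++ (f x)) (cong₂ _+_ (len (here refl)) (length-concatMap-const f n xs (len ∘ there)))

  concatMap-unique : ∀ (f : A → List B) {xs} → Unique xs →
    (∀ {x} → x ∈ xs → Unique (f x)) →
    (∀ {x y} → x ∈ xs → y ∈ xs → x ≢ y → Disjoint (f x) (f y)) →
    Unique (concatMap f xs)
  concatMap-unique f {[]}     _          _    _        = []
  concatMap-unique f {x ∷ xs} (x∉ ∷ uxs) ufx disjoint =
    Unique.++⁺ (ufx (here refl))
      (concatMap-unique f uxs (ufx ∘ there) (λ p q → disjoint (there p) (there q)))
      λ (v∈fx , v∈rest) → let y , y∈xs , v∈fy = find (∈-concatMap⁻ f v∈rest) in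
        disjoint (here refl) (there y∈xs) (All.lookup x∉ y∈xs) (v∈fx , v∈fy)

++-injectiveˡ : ∀ {A : Set} {us us′ vs vs′ : List A} →
  length us ≡ length us′ → us ++ vs ≡ us′ ++ vs′ → us ≡ us′
++-injectiveˡ {us = []}     {[]}       _   _  = refl
++-injectiveˡ {us = u ∷ us} {u′ ∷ us′} len eq with refl , eq′ ← ∷-injective eq =
  cong (u ∷_) (++-injectiveˡ (suc-injective len) eq′)

length-cartesianProduct : ∀ {A B : Set} (xs : List A) (ys : List B) →
  length (cartesianProduct xs ys) ≡ length xs * length ys
length-cartesianProduct []       ys = refl
length-cartesianProduct (x ∷ xs) ys =
  trans (length-++ (map (x ,_) ys)) (cong₂ _+_ (length-map (x ,_) ys) (length-cartesianProduct xs ys))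

module _ {A : Set} {P : A → Set} (P? : Decidable P) where

  length-filter+length-filter-¬ : ∀ xs →
    length (filter P? xs) + length (filter (¬? ∘ P?) xs) ≡ length xs
  length-filter+length-filter-¬ []       = refl
  length-filter+length-filter-¬ (x ∷ xs) with P? x
  ... | yes _ = cong suc (length-filter+length-filter-¬ xs)
  ... | no  _ = trans (+-suc _ _) (cong suc (length-filter+length-filter-¬ xs))

module _ {A B : Set} (R : A → B → Set) where

  injective-relation⇒length≤ : ∀ {xs ys} → Unique xs →
    (∀ {x} → x ∈ xs → ∃ λ y → y ∈ ys × R x y) →
    (∀ {x x′ y} → x ∈ xs → x′ ∈ xs → R x y → R x′ y → x ≡ x′) →
    length xs ≤ length ys
  injective-relation⇒length≤ {[]}     _          _       _   = z≤n
  injective-relation⇒length≤ {x ∷ xs} (x∉ ∷ uxs) partner inj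
    with y , y∈ys , Rxy ← partner (here refl)
    with us , vs , refl ← ∈-∃++ y∈ys =
    ≤-trans (s≤s (injective-relation⇒length≤ uxs partner′ (λ p q → inj (there p) (there q))))
            (≤-reflexive (sym (length-++-sucʳ us y vs)))
    where
    partner′ : ∀ {x′} → x′ ∈ xs → ∃ λ y′ → y′ ∈ us ++ vs × R x′ y′
    partner′ x′∈ with y′ , y′∈ , Rx′y′ ← partner (there x′∈) with ∈-++⁻ us y′∈
    ... | inj₁ y′∈us         = y′ , ∈-++⁺ˡ y′∈us , Rx′y′
    ... | inj₂ (there y′∈vs) = y′ , ∈-++⁺ʳ us y′∈vs , Rx′y′
    ... | inj₂ (here refl)   =
      ⊥-elim (All.lookup x∉ x′∈ (sym (inj (there x′∈) (here refl) Rx′y′ Rxy)))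

module _ {A : Set} (f : A → ℕ) where

  fibre : List A → ℕ → List A
  fibre xs v = filter (λ x → f x ≟ v) xs

  crowded-fibre : ∀ m xs {v} → m < length (fibre xs v) →
    ∃ λ x → x ∈ xs × m < length (fibre xs (f x))
  crowded-fibre m xs {v} big with fibre xs v in eq
  ... | x ∷ _ with x∈xs , refl ← ∈-filter⁻ (λ x → f x ≟ v) (subst (x ∈_) (sym eq) (here refl)) =
    x , x∈xs , subst (λ ys → m < length ys) (sym eq) big

  pigeonhole : ∀ n m xs → All (λ x → f x < n) xs → n * m < length xs →
    ∃ λ x → x ∈ xs × m < length (fibre xs (f x))
  pigeonhole zero    m (x ∷ xs) (() ∷ _) _
  pigeonhole (suc n) m xs bounded crowded with m <? length (fibre xs n)
  ... | yes big   = crowded-fibre m xs big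
  ... | no  small = lift (pigeonhole n m rest bounded-rest crowded-rest)
    where
    off-n? : Decidable (λ x → f x ≢ n)
    off-n? x = ¬? (f x ≟ n)
    rest : List A
    rest = filter off-n? xs
    bounded-rest : All (λ x → f x < n) rest
    bounded-rest = All.tabulate λ x∈ → let x∈xs , fx≢n = ∈-filter⁻ off-n? x∈ in
      ≤∧≢⇒< (s≤s⁻¹ (All.lookup bounded x∈xs)) fx≢n
    crowded-rest : n * m < length rest
    crowded-rest = +-cancelˡ-< m (n * m) (length rest) (begin-strict
      m + n * m                              <⟨ crowded ⟩
      length xs                              ≡⟨ length-filter+length-filter-¬ (λ x → f x ≟ n) xs ⟨
      length (fibre xs n) + length rest      ≤⟨ +-monoˡ-≤ (length rest) (≮⇒≥ small) ⟩
      m + length rest                        ∎)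
      where open ≤-Reasoning
    lift : (∃ λ x → x ∈ rest × m < length (fibre rest (f x))) →
           ∃ λ x → x ∈ xs × m < length (fibre xs (f x))
    lift (x , x∈rest , big) = x , proj₁ (∈-filter⁻ off-n? x∈rest) ,
      <-≤-trans big (length-mono-≤ (filter⁺ _ _ (λ { refl p → p }) (filter-⊆ off-n? xs)))

module _ {A : Set} where

  insertionsOf : A → List A → List (List A)
  insertionsOf x []       = (x ∷ []) ∷ []
  insertionsOf x (y ∷ ys) = (x ∷ y ∷ ys) ∷ map (y ∷_) (insertionsOf x ys)

  permutations : List A → List (List A)
  permutations []       = [] ∷ []
  permutations (x ∷ xs) = concatMap (insertionsOf x) (permutations xs)

  length-insertionsOf : ∀ x ys → length (insertionsOf x ys) ≡ suc (length ys)
  length-insertionsOf x []       = refl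
  length-insertionsOf x (y ∷ ys) =
    cong suc (trans (length-map (y ∷_) (insertionsOf x ys)) (length-insertionsOf x ys))

  ∈-insertionsOf⇒↭ : ∀ {x ys zs} → zs ∈ insertionsOf x ys → zs ↭ x ∷ ys
  ∈-insertionsOf⇒↭ {ys = []}     (here refl) = ↭-refl
  ∈-insertionsOf⇒↭ {ys = y ∷ ys} (here refl) = ↭-refl
  ∈-insertionsOf⇒↭ {x} {y ∷ ys}  (there p)   with zs , zs∈ , refl ← ∈-map⁻ (y ∷_) p =
    ↭-trans (↭-prep y (∈-insertionsOf⇒↭ zs∈)) (↭-swap y x ↭-refl)

  ∈-insertionsOf : ∀ x us vs → us ++ x ∷ vs ∈ insertionsOf x (us ++ vs)
  ∈-insertionsOf x []       []       = here refl
  ∈-insertionsOf x []       (v ∷ vs) = here refl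
  ∈-insertionsOf x (u ∷ us) vs       = there (∈-map⁺ (u ∷_) (∈-insertionsOf x us vs))

  insertionsOf-unique : ∀ {x ys} → x ∉ ys → Unique (insertionsOf x ys)
  insertionsOf-unique {ys = []}     _  = [] ∷ []
  insertionsOf-unique {x} {y ∷ ys} x∉ =
    All.tabulate head≢ ∷ Unique.map⁺ (proj₂ ∘ ∷-injective) (insertionsOf-unique (x∉ ∘ there))
    where
    head≢ : ∀ {zs} → zs ∈ map (y ∷_) (insertionsOf x ys) → x ∷ y ∷ ys ≢ zs
    head≢ zs∈ eq with _ , _ , refl ← ∈-map⁻ (y ∷_) zs∈ = x∉ (here (proj₁ (∷-injective eq)))

  insertionsOf-injective : ∀ {x ys ys′ zs} → x ∉ ys → x ∉ ys′ →
    zs ∈ insertionsOf x ys → zs ∈ insertionsOf x ys′ → ys ≡ ys′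
  insertionsOf-injective {ys = []}    {[]}     _  _   _           _           = refl
  insertionsOf-injective {ys = []}    {y ∷ ys′} _ x∉′ (here refl) (there p)
    with _ , _ , eq ← ∈-map⁻ (y ∷_) p = ⊥-elim (x∉′ (here (proj₁ (∷-injective eq))))
  insertionsOf-injective {ys = y ∷ ys} {[]}   x∉ _  (there p)   (here refl)
    with _ , _ , eq ← ∈-map⁻ (y ∷_) p = ⊥-elim (x∉ (here (proj₁ (∷-injective eq))))
  insertionsOf-injective {ys = y ∷ ys} {y′ ∷ ys′} _ _ (here refl) (here refl) = refl
  insertionsOf-injective {ys = y ∷ ys} {y′ ∷ ys′} _ x∉′ (here refl) (there p)
    with _ , _ , eq ← ∈-map⁻ (y′ ∷_) p = ⊥-elim (x∉′ (here (proj₁ (∷-injective eq))))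
  insertionsOf-injective {ys = y ∷ ys} {y′ ∷ ys′} x∉ _ (there p) (here refl)
    with _ , _ , eq ← ∈-map⁻ (y ∷_) p = ⊥-elim (x∉ (here (proj₁ (∷-injective eq))))
  insertionsOf-injective {ys = y ∷ ys} {y′ ∷ ys′} x∉ x∉′ (there p) (there p′)
    with zs , zs∈ , refl ← ∈-map⁻ (y ∷_) p | zs′ , zs′∈ , eq ← ∈-map⁻ (y′ ∷_) p′
    with refl , refl ← ∷-injective eq =
    cong (y ∷_) (insertionsOf-injective (x∉ ∘ there) (x∉′ ∘ there) zs∈ zs′∈)

  ∈-permutations⇒↭ : ∀ {xs zs} → zs ∈ permutations xs → zs ↭ xs
  ∈-permutations⇒↭ {[]}     (here refl) = ↭-refl
  ∈-permutations⇒↭ {x ∷ xs} p with ys , ys∈ , zs∈ ← find (∈-concatMap⁻ (insertionsOf x) p) =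
    ↭-trans (∈-insertionsOf⇒↭ zs∈) (↭-prep x (∈-permutations⇒↭ ys∈))

  ↭⇒∈-permutations : ∀ xs {zs} → zs ↭ xs → zs ∈ permutations xs
  ↭⇒∈-permutations []       p rewrite ↭-empty-inv p = here refl
  ↭⇒∈-permutations (x ∷ xs) p with us , vs , refl ← ∈-∃++ (∈-resp-↭ (↭-sym p) (here refl)) =
    ∈-concatMap⁺ (insertionsOf x)
      (lose (↭⇒∈-permutations xs (drop-mid us [] p)) (∈-insertionsOf x us vs))

  length-permutations : ∀ xs → length (permutations xs) ≡ length xs !
  length-permutations []       = refl
  length-permutations (x ∷ xs) = begin
    length (concatMap (insertionsOf x) (permutations xs))
      ≡⟨ length-concatMap-const (insertionsOf x) (suc (length xs)) (permutations xs) length-ins ⟩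
    length (permutations xs) * suc (length xs)  ≡⟨ cong (_* suc (length xs)) (length-permutations xs) ⟩
    length xs ! * suc (length xs)               ≡⟨ *-comm (length xs !) (suc (length xs)) ⟩
    suc (length xs) !                           ∎
    where
    open ≡-Reasoning
    length-ins : ∀ {ys} → ys ∈ permutations xs → length (insertionsOf x ys) ≡ suc (length xs)
    length-ins {ys} ys∈ =
      trans (length-insertionsOf x ys) (cong suc (↭-length (∈-permutations⇒↭ {xs} ys∈)))

  permutations-unique : ∀ {xs} → Unique xs → Unique (permutations xs)
  permutations-unique {[]}     _           = [] ∷ []
  permutations-unique {x ∷ xs} (x∉ ∷ uxs) =
    concatMap-unique (insertionsOf x) (permutations-unique uxs)
      (insertionsOf-unique ∘ x∉perm)
      λ p q ys≢ys′ (zs∈ , zs∈′) → ys≢ys′ (insertionsOf-injective (x∉perm p) (x∉perm q) zs∈ zs∈′)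
    where
    x∉perm : ∀ {ys} → ys ∈ permutations xs → x ∉ ys
    x∉perm ys∈ x∈ys = All.lookup x∉ (∈-resp-↭ (∈-permutations⇒↭ {xs} ys∈) x∈ys) refl

module _ {A : Set} where

  concatenations : ℕ → List (List A) → List (List A)
  concatenations zero    P = [] ∷ []
  concatenations (suc r) P = concatMap (λ π → map (π ++_) (concatenations r P)) P

  ∈-concatenations⁻ : ∀ r P {t} → t ∈ concatenations (suc r) P →
    ∃₂ λ π s → π ∈ P × s ∈ concatenations r P × t ≡ π ++ s
  ∈-concatenations⁻ r P t∈
    with π , π∈ , t∈πs ← find (∈-concatMap⁻ (λ π → map (π ++_) (concatenations r P)) t∈)
    with s , s∈ , refl ← ∈-map⁻ (π ++_) t∈πs = π , s , π∈ , s∈ , refl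

  length-concatenations : ∀ r P → length (concatenations r P) ≡ length P ^ r
  length-concatenations zero    P = refl
  length-concatenations (suc r) P = begin
    length (concatenations (suc r) P)
      ≡⟨ length-concatMap-const (λ π → map (π ++_) (concatenations r P)) _ P
           (λ {π} _ → length-map (π ++_) (concatenations r P)) ⟩
    length P * length (concatenations r P) ≡⟨ cong (length P *_) (length-concatenations r P) ⟩
    length P * length P ^ r               ∎
    where open ≡-Reasoning

  ∈-concatenations⇒length : ∀ r {n P t} → All (λ π → length π ≡ n) P →
    t ∈ concatenations r P → length t ≡ r * n
  ∈-concatenations⇒length zero    _   (here refl) = refl
  ∈-concatenations⇒length (suc r) {n} {P} lengths t∈
    with π , s , π∈ , s∈ , refl ← ∈-concatenations⁻ r P t∈ =
    trans (length-++ π) (cong₂ _+_ (All.lookup lengths π∈) (∈-concatenations⇒length r lengths s∈))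

  ∈-concatenations⇒All : ∀ r {Q : A → Set} {P t} →
    All (All Q) P → t ∈ concatenations r P → All Q t
  ∈-concatenations⇒All zero    _  (here refl) = []
  ∈-concatenations⇒All (suc r) {P = P} QP t∈
    with π , s , π∈ , s∈ , refl ← ∈-concatenations⁻ r P t∈ =
    All.++⁺ (All.lookup QP π∈) (∈-concatenations⇒All r QP s∈)

  ∈-concatenations⇒↭ : ∀ r {P t t′} → (∀ {π π′} → π ∈ P → π′ ∈ P → π ↭ π′) →
    t ∈ concatenations r P → t′ ∈ concatenations r P → t ↭ t′
  ∈-concatenations⇒↭ zero    _    (here refl) (here refl) = ↭-refl
  ∈-concatenations⇒↭ (suc r) {P} perm t∈ t′∈
    with π , s , π∈ , s∈ , refl ← ∈-concatenations⁻ r P t∈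
    with π′ , s′ , π′∈ , s′∈ , refl ← ∈-concatenations⁻ r P t′∈ =
    ++⁺ (perm π∈ π′∈) (∈-concatenations⇒↭ r perm s∈ s′∈)

  concatenations-unique : ∀ r {n P} →
    All (λ π → length π ≡ n) P → Unique P → Unique (concatenations r P)
  concatenations-unique zero    _       _  = [] ∷ []
  concatenations-unique (suc r) {P = P} lengths uP =
    concatMap-unique (λ π → map (π ++_) (concatenations r P)) uP
      (λ {π} _ → Unique.map⁺ (++-cancelˡ π _ _) (concatenations-unique r lengths uP))
      λ {π} {π′} π∈ π′∈ π≢π′ (t∈ , t∈′) →
        let s , _ , eq = ∈-map⁻ (π ++_) t∈; s′ , _ , eq′ = ∈-map⁻ (π′ ++_) t∈′ in
        π≢π′ (++-injectiveˡ (trans (All.lookup lengths π∈) (sym (All.lookup lengths π′∈)))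
                            (trans (sym eq) eq′))

-- The Abelian class and the multiplicity

insertions≡insertionsOf : ∀ a w → insertions a w ≡ insertionsOf a w
insertions≡insertionsOf a []      = refl
insertions≡insertionsOf a (b ∷ w) =
  cong (λ ws → (a ∷ b ∷ w) ∷ map (b ∷_) ws) (insertions≡insertionsOf a w)

perms≡permutations : ∀ w → perms w ≡ permutations w
perms≡permutations []      = refl
perms≡permutations (a ∷ w) =
  trans (concatMap-cong (insertions≡insertionsOf a) (perms w))
        (cong (concatMap (insertionsOf a)) (perms≡permutations w))

~-refl : ∀ {x} → x ~ x
~-refl = inj₁ refl

~-sym : ∀ {x y} → x ~ y → y ~ x
~-sym         (inj₁ refl) = inj₁ refl
~-sym {y = y} (inj₂ refl) = inj₂ (sym (reverse-involutive y))

~-trans : ∀ {x y z} → x ~ y → y ~ z → x ~ z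
~-trans         (inj₁ refl) y~z         = y~z
~-trans         (inj₂ refl) (inj₁ refl) = inj₂ refl
~-trans {z = z} (inj₂ refl) (inj₂ refl) = inj₁ (reverse-involutive z)

K-resp-~ : ∀ {x y} → x ~ y → K x ≡ K y
K-resp-~         (inj₁ refl) = refl
K-resp-~ {y = y} (inj₂ refl) = K-reverse y

∈-abelianClass : ∀ {y z} → z ↭ y → ∃ λ x → x ∈ abelianClass y × x ~ z
∈-abelianClass {y} {z} z↭y =
  find (Any.deduplicate⁺ _~?_ resp (Any.map (λ { refl → ~-refl }) z∈perms))
  where
  resp : ∀ {x x′} → x′ ~ x → x ~ z → x′ ~ z
  resp = ~-trans
  z∈perms : z ∈ perms y
  z∈perms = subst (z ∈_) (sym (perms≡permutations y)) (↭⇒∈-permutations y z↭y)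

length≤μ : ∀ y {zs} → Unique zs → All (_↭ y) zs → All (λ z → K z ≡ K y) zs →
  (∀ {z z′} → z ∈ zs → z′ ∈ zs → z ~ z′ → z ≡ z′) → length zs ≤ μ y
length≤μ y {zs} uzs perm sameK rigid =
  injective-relation⇒length≤ (λ z x → x ~ z) uzs partner
    (λ p q x~z x~z′ → rigid p q (~-trans (~-sym x~z) x~z′))
  where
  partner : ∀ {z} → z ∈ zs → ∃ λ x → x ∈ filter (λ x → K x ≟ K y) (abelianClass y) × x ~ z
  partner z∈ with x , x∈ , x~z ← ∈-abelianClass (All.lookup perm z∈) =
    x , ∈-filter⁺ (λ x → K x ≟ K y) x∈ (trans (K-resp-~ x~z) (All.lookup sameK z∈)) , x~z

pigeonhole-μ : ∀ n m {zs} → Unique zs →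
  (∀ {z z′} → z ∈ zs → z′ ∈ zs → z ↭ z′) →
  (∀ {z z′} → z ∈ zs → z′ ∈ zs → z ~ z′ → z ≡ z′) →
  All (λ z → K z < n) zs → n * m < length zs →
  ∃ λ w → w ∈ zs × m < μ w
pigeonhole-μ n m {zs} uzs perm rigid bounded crowded
  with w , w∈zs , big ← pigeonhole K n m zs bounded crowded =
  w , w∈zs , <-≤-trans big (length≤μ w (Unique.filter⁺ sameK? uzs)
    (All.tabulate λ z∈ → perm (∈zs z∈) w∈zs) (All.tabulate (proj₂ ∘ ∈-filter⁻ sameK? {xs = zs}))
    (λ z∈ z′∈ → rigid (∈zs z∈) (∈zs z′∈)))
  where
  sameK? : Decidable (λ z → K z ≡ K w)
  sameK? z = K z ≟ K w
  ∈zs : ∀ {z} → z ∈ fibre K zs (K w) → z ∈ zs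
  ∈zs = proj₁ ∘ ∈-filter⁻ sameK? {xs = zs}

-- Factorial estimates

*-distrib-^ : ∀ a b n → (a * b) ^ n ≡ a ^ n * b ^ n
*-distrib-^ a b zero    = refl
*-distrib-^ a b (suc n) = trans (cong (a * b *_) (*-distrib-^ a b n)) (regroup a b (a ^ n) (b ^ n))
  where
  regroup : ∀ a b x y → a * b * (x * y) ≡ a * x * (b * y)
  regroup = solve-∀

-- Bernoulli's inequality (1 - 1/(c+1))^m ≥ 1 - m/(c+1), cleared of denominators.
bernoulli : ∀ c m → suc c * suc c ^ m ≤ suc c * c ^ m + m * suc c ^ m
bernoulli c zero    = m≤m+n (suc c * 1) 0
bernoulli c (suc m) = begin
  d * (d * d ^ m)                                ≤⟨ *-monoʳ-≤ d (bernoulli c m) ⟩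
  d * (d * c ^ m + m * d ^ m)                    ≡⟨ regroup c (c ^ m) (d ^ m) m ⟩
  d * (c * c ^ m) + d * c ^ m + m * (d * d ^ m)
    ≤⟨ +-monoˡ-≤ _ (+-monoʳ-≤ (d * (c * c ^ m)) (*-monoʳ-≤ d (^-monoˡ-≤ m (n≤1+n c)))) ⟩
  d * (c * c ^ m) + d * d ^ m + m * (d * d ^ m)  ≡⟨ regroup′ c (c ^ m) (d ^ m) m ⟩
  d * (c * c ^ m) + suc m * (d * d ^ m)          ∎
  where
  open ≤-Reasoning
  d : ℕ
  d = suc c
  regroup : ∀ c x y m → suc c * (suc c * x + m * y) ≡ suc c * (c * x) + suc c * x + m * (suc c * y)
  regroup = solve-∀
  regroup′ : ∀ c x y m →
    suc c * (c * x) + suc c * y + m * (suc c * y) ≡ suc c * (c * x) + suc m * (suc c * y)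
  regroup′ = solve-∀

[1+c]^m≤2*c^m : ∀ c m → m + m ≤ suc c → suc c ^ m ≤ 2 * c ^ m
[1+c]^m≤2*c^m c m 2m≤d = *-cancelˡ-≤ d (+-cancelʳ-≤ (d * P) (d * P) (d * (2 * c ^ m)) (begin
  d * P + d * P                      ≡⟨ regroup d P ⟩
  2 * (d * P)                        ≤⟨ *-monoʳ-≤ 2 (bernoulli c m) ⟩
  2 * (d * c ^ m + m * P)            ≡⟨ regroup′ d (c ^ m) m P ⟩
  d * (2 * c ^ m) + (m + m) * P      ≤⟨ +-monoʳ-≤ (d * (2 * c ^ m)) (*-monoˡ-≤ P 2m≤d) ⟩
  d * (2 * c ^ m) + d * P            ∎))
  where
  open ≤-Reasoning
  d P : ℕ
  d = suc c
  P = suc c ^ m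
  regroup : ∀ d P → d * P + d * P ≡ 2 * (d * P)
  regroup = solve-∀
  regroup′ : ∀ d x m P → 2 * (d * x + m * P) ≡ d * (2 * x) + (m + m) * P
  regroup′ = solve-∀

⌊n/2⌋+⌊n/2⌋≤n : ∀ n → ⌊ n /2⌋ + ⌊ n /2⌋ ≤ n
⌊n/2⌋+⌊n/2⌋≤n zero          = z≤n
⌊n/2⌋+⌊n/2⌋≤n (suc zero)    = z≤n
⌊n/2⌋+⌊n/2⌋≤n (suc (suc n)) =
  s≤s (≤-trans (≤-reflexive (+-suc ⌊ n /2⌋ ⌊ n /2⌋)) (s≤s (⌊n/2⌋+⌊n/2⌋≤n n)))

[1+n]^n≤4*n^n : ∀ n → suc n ^ n ≤ 4 * n ^ n
[1+n]^n≤4*n^n n = begin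
  suc n ^ n                    ≡⟨ cong (suc n ^_) (⌊n/2⌋+⌈n/2⌉≡n n) ⟨
  suc n ^ (h + h′)             ≡⟨ ^-distribˡ-+-* (suc n) h h′ ⟩
  suc n ^ h * suc n ^ h′       ≤⟨ *-mono-≤ ([1+c]^m≤2*c^m n h (m≤n⇒m≤1+n (⌊n/2⌋+⌊n/2⌋≤n n)))
                                           ([1+c]^m≤2*c^m n h′ (⌊n/2⌋+⌊n/2⌋≤n (suc n))) ⟩
  2 * n ^ h * (2 * n ^ h′)     ≡⟨ regroup (n ^ h) (n ^ h′) ⟩
  4 * (n ^ h * n ^ h′)         ≡⟨ cong (4 *_) (^-distribˡ-+-* n h h′) ⟨
  4 * n ^ (h + h′)             ≡⟨ cong (λ e → 4 * n ^ e) (⌊n/2⌋+⌈n/2⌉≡n n) ⟩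
  4 * n ^ n                    ∎
  where
  open ≤-Reasoning
  h h′ : ℕ
  h  = ⌊ n /2⌋
  h′ = ⌈ n /2⌉
  regroup : ∀ x y → 2 * x * (2 * y) ≡ 4 * (x * y)
  regroup = solve-∀

n^n≤4^n*n! : ∀ n → n ^ n ≤ 4 ^ n * n !
n^n≤4^n*n! zero    = ≤-refl
n^n≤4^n*n! (suc n) = begin
  suc n * suc n ^ n            ≤⟨ *-monoʳ-≤ (suc n) ([1+n]^n≤4*n^n n) ⟩
  suc n * (4 * n ^ n)          ≤⟨ *-monoʳ-≤ (suc n) (*-monoʳ-≤ 4 (n^n≤4^n*n! n)) ⟩
  suc n * (4 * (4 ^ n * n !))  ≡⟨ regroup (suc n) (4 ^ n) (n !) ⟩
  4 * 4 ^ n * (suc n * n !)    ∎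
  where
  open ≤-Reasoning
  regroup : ∀ a x y → a * (4 * (x * y)) ≡ 4 * x * (a * y)
  regroup = solve-∀

[2*m]^n≤n! : ∀ m n → 8 * m ≤ n → (2 * m) ^ n ≤ n !
[2*m]^n≤n! m n 8m≤n = *-cancelˡ-≤ (4 ^ n) {{m^n≢0 4 n}} (begin
  4 ^ n * (2 * m) ^ n     ≡⟨ *-distrib-^ 4 (2 * m) n ⟨
  (4 * (2 * m)) ^ n       ≡⟨ cong (_^ n) (sym (*-assoc 4 2 m)) ⟩
  (8 * m) ^ n             ≤⟨ ^-monoˡ-≤ n 8m≤n ⟩
  n ^ n                   ≤⟨ n^n≤4^n*n! n ⟩
  4 ^ n * n !             ∎)
  where open ≤-Reasoning

n<2^n : ∀ n → n < 2 ^ n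
n<2^n zero    = s≤s z≤n
n<2^n (suc n) = ≤-trans (s≤s (n<2^n n))
  (≤-trans (≤-reflexive (+-comm 1 (2 ^ n))) (+-monoʳ-≤ (2 ^ n) (≤-trans (m^n>0 2 n) (m≤m+n (2 ^ n) 0))))

2*m^n≤n! : ∀ m n → 1 ≤ n → 8 * m ≤ n → 2 * m ^ n ≤ n !
2*m^n≤n! m n 1≤n 8m≤n = begin
  2 * m ^ n         ≤⟨ *-monoˡ-≤ (m ^ n) (^-monoʳ-≤ 2 1≤n) ⟩
  2 ^ n * m ^ n     ≡⟨ *-distrib-^ 2 m n ⟨
  (2 * m) ^ n       ≤⟨ [2*m]^n≤n! m n 8m≤n ⟩
  n !               ∎
  where open ≤-Reasoning

[1+c*X^[r*N]]*k<[N!]^r : ∀ c X N k → 1 ≤ c → 1 ≤ X → 2 * X ^ N ≤ N ! →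
  let r = 2 * c * k in suc (c * X ^ (r * N)) * k < (N !) ^ r
[1+c*X^[r*N]]*k<[N!]^r c X N k 1≤c 1≤X 2X^N≤N! = begin-strict
  suc (c * Y) * k          ≤⟨ *-monoˡ-≤ k (+-monoˡ-≤ (c * Y) (*-mono-≤ 1≤c 1≤Y)) ⟩
  (c * Y + c * Y) * k      ≡⟨ regroup c Y k ⟩
  r * Y                    <⟨ *-monoˡ-< Y {{>-nonZero 1≤Y}} (n<2^n r) ⟩
  2 ^ r * Y                ≡⟨ cong (2 ^ r *_) (trans (cong (X ^_) (*-comm r N)) (sym (^-*-assoc X N r))) ⟩
  2 ^ r * (X ^ N) ^ r      ≡⟨ *-distrib-^ 2 (X ^ N) r ⟨
  (2 * X ^ N) ^ r          ≤⟨ ^-monoˡ-≤ r 2X^N≤N! ⟩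
  (N !) ^ r                ∎
  where
  open ≤-Reasoning
  r Y : ℕ
  r = 2 * c * k
  Y = X ^ (r * N)
  1≤Y : 1 ≤ Y
  1≤Y = ≤-trans (≤-reflexive (sym (^-zeroˡ (r * N)))) (^-monoˡ-≤ (r * N) 1≤X)
  regroup : ∀ c Y k → (c * Y + c * Y) * k ≡ 2 * c * k * Y
  regroup = solve-∀

-- A dyadic staircase of blocks

IsBlock : ℕ → ℕ → ℕ × ℕ → Set
IsBlock L X (a , b) = L ≤ a × L ≤ b × suc a * suc b ≤ X

interval : ℕ → ℕ → List ℕ
interval s n = applyUpTo (s +_) n

interval-unique : ∀ s n → Unique (interval s n)
interval-unique s n = Unique.applyUpTo⁺₁ (s +_) n (λ i<j _ → <⇒≢ (+-monoʳ-< s i<j))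

∈-interval⁻ : ∀ {s n v} → v ∈ interval s n → s ≤ v × v < s + n
∈-interval⁻ {s} v∈ with i , i<n , refl ← ∈-applyUpTo⁻ (s +_) v∈ = m≤m+n s i , +-monoʳ-< s i<n

rectangle : ℕ → ℕ → ℕ → List (ℕ × ℕ)
rectangle L u v = cartesianProduct (interval (u * L) (u * L)) (interval L (v * L))

-- The rectangles [2ʲL, 2ʲ⁺¹L) × [L, (1 + vⱼ)L), j < k, with 2ʲ(1 + vⱼ) = 2ᵏ⁻¹(1 + v):
-- a dyadic staircase under the hyperbola (a + 1)(b + 1) = 2ᵏ(1 + v)L².
staircase : ℕ → ℕ → ℕ → List (ℕ × ℕ)
staircase L zero    v = []
staircase L (suc k) v = rectangle L (2 ^ k) v ++ staircase L k (suc (2 * v))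

module _ (L : ℕ) where

  ∈-rectangle⁻ : ∀ u v {a b} → (a , b) ∈ rectangle L u v →
    (u * L ≤ a × a < u * L + u * L) × (L ≤ b × b < L + v * L)
  ∈-rectangle⁻ u v ab∈ =
    Product.map ∈-interval⁻ ∈-interval⁻
      (∈-cartesianProduct⁻ (interval (u * L) (u * L)) (interval L (v * L)) ab∈)

  rectangle-unique : ∀ u v → Unique (rectangle L u v)
  rectangle-unique u v =
    Unique.cartesianProduct⁺ (interval-unique (u * L) (u * L)) (interval-unique L (v * L))

  length-rectangle : ∀ u v → length (rectangle L u v) ≡ u * L * (v * L)
  length-rectangle u v = trans (length-cartesianProduct (interval (u * L) (u * L)) (interval L (v * L)))
    (cong₂ _*_ (length-applyUpTo (u * L +_) (u * L)) (length-applyUpTo (L +_) (v * L)))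

  staircase-below : ∀ k v {a b} → (a , b) ∈ staircase L k v → a < 2 ^ k * L
  staircase-below (suc k) v ab∈ with ∈-++⁻ (rectangle L (2 ^ k) v) ab∈
  ... | inj₁ ab∈R =
    ≤-trans (proj₂ (proj₁ (∈-rectangle⁻ (2 ^ k) v ab∈R))) (≤-reflexive (regroup (2 ^ k) L))
    where
    regroup : ∀ x L → x * L + x * L ≡ 2 * x * L
    regroup = solve-∀
  ... | inj₂ ab∈S = <-≤-trans (staircase-below k (suc (2 * v)) ab∈S) (*-monoˡ-≤ L (m≤m+n (2 ^ k) _))

  staircase-unique : ∀ k v → Unique (staircase L k v)
  staircase-unique zero    v = []
  staircase-unique (suc k) v =
    Unique.++⁺ (rectangle-unique (2 ^ k) v)
      (staircase-unique k (suc (2 * v)))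
      λ { {a , b} (ab∈R , ab∈S) →
          <⇒≱ (staircase-below k (suc (2 * v)) ab∈S) (proj₁ (proj₁ (∈-rectangle⁻ (2 ^ k) v ab∈R))) }

  staircase-blocks : ∀ k v {ab} → ab ∈ staircase L k v → IsBlock L (2 ^ k * suc v * (L * L)) ab
  staircase-blocks (suc k) v ab∈ with ∈-++⁻ (rectangle L (2 ^ k) v) ab∈
  ... | inj₁ ab∈R with (uL≤a , a<2uL) , (L≤b , b<L+vL) ← ∈-rectangle⁻ (2 ^ k) v ab∈R =
    ≤-trans (≤-trans (≤-reflexive (sym (*-identityˡ L))) (*-monoˡ-≤ L (m^n>0 2 k))) uL≤a , L≤b ,
    ≤-trans (*-mono-≤ a<2uL b<L+vL) (≤-reflexive (regroup (2 ^ k) v L))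
    where
    regroup : ∀ x v L → (x * L + x * L) * (L + v * L) ≡ 2 * x * suc v * (L * L)
    regroup = solve-∀
  ... | inj₂ ab∈S with L≤a , L≤b , ab≤ ← staircase-blocks k (suc (2 * v)) ab∈S =
    L≤a , L≤b , ≤-trans ab≤ (≤-reflexive (regroup (2 ^ k) v L))
    where
    regroup : ∀ x v L → x * suc (suc (2 * v)) * (L * L) ≡ 2 * x * suc v * (L * L)
    regroup = solve-∀

  staircase-size : ∀ k v → 1 ≤ v → k * (2 ^ k * suc v * (L * L)) ≤ 4 * length (staircase L k v)
  staircase-size zero    v _   = z≤n
  staircase-size (suc k) v 1≤v = begin
    suc k * (2 ^ suc k * suc v * (L * L))
      ≡⟨ regroup (2 ^ k) v k (L * L) ⟩
    2 ^ k * (L * L) * (2 * suc v) + k * (2 ^ k * suc (suc (2 * v)) * (L * L))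
      ≤⟨ +-mono-≤ (*-monoʳ-≤ (2 ^ k * (L * L)) 2[1+v]≤4v) (staircase-size k (suc (2 * v)) (s≤s z≤n)) ⟩
    2 ^ k * (L * L) * (4 * v) + 4 * length (staircase L k (suc (2 * v)))
      ≡⟨ cong (_+ 4 * length (staircase L k (suc (2 * v)))) (regroup′ (2 ^ k) v L) ⟩
    4 * (2 ^ k * L * (v * L)) + 4 * length (staircase L k (suc (2 * v)))
      ≡⟨ cong (λ n → 4 * n + 4 * length (staircase L k (suc (2 * v)))) (length-rectangle (2 ^ k) v) ⟨
    4 * length (rectangle L (2 ^ k) v) + 4 * length (staircase L k (suc (2 * v)))
      ≡⟨ *-distribˡ-+ 4 (length (rectangle L (2 ^ k) v)) _ ⟨
    4 * (length (rectangle L (2 ^ k) v) + length (staircase L k (suc (2 * v))))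
      ≡⟨ cong (4 *_) (length-++ (rectangle L (2 ^ k) v)) ⟨
    4 * length (staircase L (suc k) v) ∎
    where
    open ≤-Reasoning
    2[1+v]≤4v : 2 * suc v ≤ 4 * v
    2[1+v]≤4v = ≤-trans (*-monoʳ-≤ 2 (+-monoˡ-≤ v 1≤v)) (≤-reflexive (regroup″ v))
      where
      regroup″ : ∀ v → 2 * (v + v) ≡ 4 * v
      regroup″ = solve-∀
    regroup : ∀ x v k LL →
      suc k * (2 * x * suc v * LL) ≡ x * LL * (2 * suc v) + k * (x * suc (suc (2 * v)) * LL)
    regroup = solve-∀
    regroup′ : ∀ x v L → x * (L * L) * (4 * v) ≡ 4 * (x * L * (v * L))
    regroup′ = solve-∀

-- Framed words

flat : List (ℕ × ℕ) → Word
flat []            = []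
flat ((a , b) ∷ t) = a ∷ b ∷ flat t

flat-injective : ∀ {t t′} → flat t ≡ flat t′ → t ≡ t′
flat-injective {[]}          {[]}            _  = refl
flat-injective {(a , b) ∷ t} {(a′ , b′) ∷ t′} eq
  with refl , eq′  ← ∷-injective eq
  with refl , eq″ ← ∷-injective eq′ = cong ((a , b) ∷_) (flat-injective eq″)

flat-↭ : ∀ {t t′} → t ↭ t′ → flat t ↭ flat t′
flat-↭ ↭.refl                          = ↭-refl
flat-↭ (↭.prep (a , b) p)              = ↭-prep a (↭-prep b (flat-↭ p))
flat-↭ (↭.swap (a , b) (a′ , b′) p)    =
  ↭-trans (↭-prep a (↭-prep b (↭-prep a′ (↭-prep b′ (flat-↭ p)))))
          (shifts (a ∷ b ∷ []) (a′ ∷ b′ ∷ []))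
flat-↭ (↭.trans p q)                   = ↭-trans (flat-↭ p) (flat-↭ q)

sucProduct-flat≤ : ∀ X {t} →
  All (λ (a , b) → suc a * suc b ≤ X) t → sucProduct (flat t) ≤ X ^ length t
sucProduct-flat≤ X []                          = ≤-refl
sucProduct-flat≤ X {(a , b) ∷ t} (ab≤X ∷ t≤X) =
  ≤-trans (≤-reflexive (sym (*-assoc (suc a) (suc b) (sucProduct (flat t)))))
          (*-mono-≤ ab≤X (sucProduct-flat≤ X t≤X))

framed : ℕ → List (ℕ × ℕ) → Word
framed L t = L ∷ flat t ++ suc L ∷ []

framed-injective : ∀ L {t t′} → framed L t ≡ framed L t′ → t ≡ t′
framed-injective L {t} {t′} eq = flat-injective (∷ʳ-injectiveˡ (flat t) (flat t′) (∷-injectiveʳ eq))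

framed-↭ : ∀ L {t t′} → t ↭ t′ → framed L t ↭ framed L t′
framed-↭ L p = ↭-prep L (++⁺ʳ (suc L ∷ []) (flat-↭ p))

framed-rigid : ∀ L {t t′} → framed L t ~ framed L t′ → framed L t ≡ framed L t′
framed-rigid L (inj₁ eq) = eq
framed-rigid L {t} {t′} (inj₂ eq) = ⊥-elim (1+n≢n (sym (∷-injectiveˡ (trans eq reversed))))
  where
  reversed : reverse (framed L t′) ≡ suc L ∷ reverse (flat t′) ++ L ∷ []
  reversed = trans (unfold-reverse L (flat t′ ++ suc L ∷ []))
                   (cong (_++ L ∷ []) (reverse-++ (flat t′) (suc L ∷ [])))

module FramedWords
  (L X : ℕ) (B : List (ℕ × ℕ)) (B-unique : Unique B) (B-blocks : All (IsBlock L X) B) where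

  N frameWeight : ℕ
  N           = length B
  frameWeight = suc L * suc (suc L)

  arrangements : ℕ → List (List (ℕ × ℕ))
  arrangements r = concatenations r (permutations B)

  words : ℕ → List Word
  words r = map (framed L) (arrangements r)

  private
    permutations-length : All (λ π → length π ≡ N) (permutations B)
    permutations-length = All.tabulate (↭-length ∘ ∈-permutations⇒↭ {xs = B})

    ∈-words⁻ : ∀ r {z} → z ∈ words r → ∃ λ t → t ∈ arrangements r × z ≡ framed L t
    ∈-words⁻ r z∈ = ∈-map⁻ (framed L) z∈

    arrangement-blocks : ∀ r {t} → t ∈ arrangements r → All (IsBlock L X) t
    arrangement-blocks r = ∈-concatenations⇒All r
      (All.tabulate λ π∈ → All-resp-↭ (↭-sym (∈-permutations⇒↭ {xs = B} π∈)) B-blocks)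

  length-words : ∀ r → length (words r) ≡ (N !) ^ r
  length-words r = begin
    length (words r)               ≡⟨ length-map (framed L) (arrangements r) ⟩
    length (arrangements r)        ≡⟨ length-concatenations r (permutations B) ⟩
    length (permutations B) ^ r    ≡⟨ cong (_^ r) (length-permutations B) ⟩
    (N !) ^ r                      ∎
    where open ≡-Reasoning

  words-unique : ∀ r → Unique (words r)
  words-unique r = Unique.map⁺ (framed-injective L)
    (concatenations-unique r permutations-length (permutations-unique B-unique))

  words-↭ : ∀ r {z z′} → z ∈ words r → z′ ∈ words r → z ↭ z′
  words-↭ r z∈ z′∈ with t , t∈ , refl ← ∈-words⁻ r z∈ | t′ , t′∈ , refl ← ∈-words⁻ r z′∈ =
    framed-↭ L (∈-concatenations⇒↭ r (λ π∈ π′∈ → ↭-trans (↭B π∈) (↭-sym (↭B π′∈))) t∈ t′∈)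
    where
    ↭B : ∀ {π} → π ∈ permutations B → π ↭ B
    ↭B = ∈-permutations⇒↭ {xs = B}

  words-rigid : ∀ r {z z′} → z ∈ words r → z′ ∈ words r → z ~ z′ → z ≡ z′
  words-rigid r z∈ z′∈ with t , _ , refl ← ∈-words⁻ r z∈ | t′ , _ , refl ← ∈-words⁻ r z′∈ =
    framed-rigid L

  words-letters : ∀ r {z} → z ∈ words r → All (λ a → L ≤ a × a ≤ suc L + X) z
  words-letters r z∈ with t , t∈ , refl ← ∈-words⁻ r z∈ =
    (≤-refl , ≤-trans (n≤1+n L) (m≤m+n (suc L) X)) ∷
    All.++⁺ (flat-letters (arrangement-blocks r t∈)) ((n≤1+n L , m≤m+n (suc L) X) ∷ [])
    where
    below-frame : ∀ {x} → x ≤ X → x ≤ suc L + X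
    below-frame x≤X = ≤-trans x≤X (m≤n+m X (suc L))
    flat-letters : ∀ {t} → All (IsBlock L X) t → All (λ a → L ≤ a × a ≤ suc L + X) (flat t)
    flat-letters []                                       = []
    flat-letters {(a , b) ∷ _} ((L≤a , L≤b , ab≤X) ∷ rest) =
      (L≤a , below-frame (≤-trans (n≤1+n a) (≤-trans (m≤m*n (suc a) (suc b)) ab≤X))) ∷
      (L≤b , below-frame (≤-trans (n≤1+n b) (≤-trans (m≤n*m (suc b) (suc a)) ab≤X))) ∷ flat-letters rest

  K-words≤ : ∀ r {z} → z ∈ words r → K z ≤ frameWeight * X ^ (r * N)
  K-words≤ r z∈ with t , t∈ , refl ← ∈-words⁻ r z∈ = begin
    K (framed L t)                                        ≤⟨ K≤sucProduct (framed L t) ⟩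
    suc L * sucProduct (flat t ++ suc L ∷ [])
      ≡⟨ cong (suc L *_) (sucProduct-++ (flat t) (suc L ∷ [])) ⟩
    suc L * (sucProduct (flat t) * (suc (suc L) * 1))     ≤⟨ *-monoʳ-≤ (suc L) (*-monoˡ-≤ _ flat≤) ⟩
    suc L * (X ^ (r * N) * (suc (suc L) * 1))             ≡⟨ regroup (suc L) (suc (suc L)) (X ^ (r * N)) ⟩
    frameWeight * X ^ (r * N)                             ∎
    where
    open ≤-Reasoning
    flat≤ : sucProduct (flat t) ≤ X ^ (r * N)
    flat≤ = ≤-trans (sucProduct-flat≤ X (All.map (proj₂ ∘ proj₂) (arrangement-blocks r t∈)))
                    (≤-reflexive (cong (X ^_) (∈-concatenations⇒length r permutations-length t∈)))
    regroup : ∀ a b x → a * (x * (b * 1)) ≡ a * b * x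
    regroup = solve-∀

  crowded-words : 1 ≤ X → 8 * X ≤ N → ∀ k →
    let r = 2 * frameWeight * k in suc (frameWeight * X ^ (r * N)) * k < length (words r)
  crowded-words 1≤X 8X≤N k =
    <-≤-trans ([1+c*X^[r*N]]*k<[N!]^r frameWeight X N k (s≤s z≤n) 1≤X (2*m^n≤n! X N 1≤N 8X≤N))
              (≤-reflexive (sym (length-words (2 * frameWeight * k))))
    where
    1≤N : 1 ≤ N
    1≤N = ≤-trans 1≤X (≤-trans (m≤n*m X 8) 8X≤N)

mainTheorem1 :
    (t l : ℕ) (b : Fin t → ℕ) →
    1 ≤ t → t ≤ l →
    (∀ i j → i <ᶠ j → b i < b j) →
    (∀ i → 1 ≤ b i) →
    (∀ i → b i ≤ l) →
    Σ ℕ λ S → (s : ℕ) → S ≤ s → l < s →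
      Σ (ℕ → Word) λ w →
        ((k : ℕ) → All (InAlphabet t l s b) (w k)) ×
        ((M : ℕ) → Σ ℕ λ N → (k : ℕ) → N ≤ k → M ≤ μ (w k))
mainTheorem1 t l b _ _ _ _ _ = suc L + X , λ s S≤s _ → w , letters S≤s , unbounded
  where
  L X : ℕ
  L = suc l
  X = 2 ^ 32 * 2 * (L * L)
  open FramedWords L X (staircase L 32 1) (staircase-unique L 32 1) (All.tabulate (staircase-blocks L 32 1))
  1≤X : 1 ≤ X
  1≤X = *-mono-≤ {1} {2 ^ 32 * 2} {1} {L * L} (s≤s z≤n) (s≤s z≤n)
  8X≤N : 8 * X ≤ N
  8X≤N = *-cancelˡ-≤ 4 (≤-trans (≤-reflexive (sym (*-assoc 4 8 X))) (staircase-size L 32 1 (s≤s z≤n)))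
  r : ℕ → ℕ
  r k = 2 * frameWeight * k
  witness : ∀ k → ∃ λ w → w ∈ words (r k) × k < μ w
  witness k = pigeonhole-μ _ k (words-unique (r k)) (words-↭ (r k)) (words-rigid (r k))
    (All.tabulate (s≤s ∘ K-words≤ (r k))) (crowded-words 1≤X 8X≤N k)
  w : ℕ → Word
  w = proj₁ ∘ witness
  letters : ∀ {s} → suc L + X ≤ s → ∀ k → All (InAlphabet t l s b) (w k)
  letters S≤s k = All.map (λ (L≤a , a≤S) → inj₂ (L≤a , ≤-trans a≤S S≤s))
                          (words-letters (r k) (proj₁ (proj₂ (witness k))))
  unbounded : ∀ M → Σ ℕ λ n → ∀ k → n ≤ k → M ≤ μ (w k)
  unbounded M = M , λ k M≤k → ≤-trans M≤k (<⇒≤ (proj₂ (proj₂ (witness k))))
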